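{- For every integer $n\geq 6$, the $n$-dimensional hypercube graph $Q_n$ satisfies $\mathrm{sn}(Q_n)<2^{n-1}$.
   Context: $Q_n$ has vertex set $\{0,1\}^n$, two vertices adjacent iff they differ in exactly one coordinate. A scramble on $G$ is a collection $\mathcal{S}$ of nonempty vertex sets each inducing a connected subgraph (eggs); $h(\mathcal{S})$ is the minimum size of a set meeting every egg; an egg-cut is $A\subseteq V(G)$ with both $A$ and $A^C$ containing an egg, of size $|E(A,A^C)|$ (number of edges between $A$ and $A^C$); $e(\mathcal{S})$ is the minimum size of an egg-cut ($\infty$ if none); the order is $\min(h(\mathcal{S}),e(\mathcal{S}))$; $\mathrm{sn}(G)$ is the maximum order of a scramble on $G$. -}

module Defs where

open import Data.Nat using (ℕ; zero; suc; _≤_; _<_; _^_; _∸_)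
open import Data.Bool using (Bool; true; false; not; _∧_)
open import Data.Fin using (Fin)
open import Data.Vec using (Vec; []; _∷_)
open import Data.List using (List; []; _∷_; length; filter; map; concatMap; _++_)
open import Data.List.Membership.Propositional using (_∈_)
open import Data.Product using (Σ; _×_; ∃; ∃-syntax)
open import Relation.Binary.PropositionalEquality using (_≡_)
open import Relation.Nullary using (¬_)
open import Data.Bool.Properties using (T?)
open import Data.Bool using (T)

-- Finite simple graphs, given by an exhaustive duplicate-free list of
-- vertices and a Boolean adjacency relation.

record FinGraph : Set₁ where
  field
    V     : Set
    verts : List V
    adj   : V → V → Bool

VSet : FinGraph → Set
VSet G = FinGraph.V G → Bool

module _ (G : FinGraph) where
  open FinGraph G

  size : VSet G → ℕ
  size A = length (filter (λ v → T? (A v)) verts)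

  complement : VSet G → VSet G
  complement A v = not (A v)

  -- |E(A, A^C)| : ordered pairs (u , w) with u ∈ A, w ∉ A, u ~ w;
  -- each such edge is counted exactly once.
  cutSize : VSet G → ℕ
  cutSize A = length (filter (λ p → T? (A (Data.Product.proj₁ p) ∧ (not (A (Data.Product.proj₂ p)) ∧ adj (Data.Product.proj₁ p) (Data.Product.proj₂ p))))
                              (concatMap (λ u → map (λ w → (u Data.Product., w)) verts) verts))

  _⊆_ : VSet G → VSet G → Set
  A ⊆ B = ∀ v → A v ≡ true → B v ≡ true

  data Reach (E : VSet G) : V → V → Set where
    here : ∀ {u} → Reach E u u
    step : ∀ {u v w} → adj u v ≡ true → E v ≡ true → Reach E v w → Reach E u w

  InducesConnected : VSet G → Set
  InducesConnected E = ∀ u v → E u ≡ true → E v ≡ true → Reach E u v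

  Nonempty : VSet G → Set
  Nonempty E = ∃[ v ] (E v ≡ true)

  record Scramble : Set where
    field
      eggs      : List (VSet G)
      nonempty  : ∀ {E} → E ∈ eggs → Nonempty E
      connected : ∀ {E} → E ∈ eggs → InducesConnected E

  module _ (S : Scramble) where
    open Scramble S

    Hits : VSet G → Set
    Hits T = ∀ {E} → E ∈ eggs → ∃[ v ] (T v ≡ true × E v ≡ true)

    ContainsEgg : VSet G → Set
    ContainsEgg A = ∃[ E ] (E ∈ eggs × E ⊆ A)

    IsEggCut : VSet G → Set
    IsEggCut A = ContainsEgg A × ContainsEgg (complement A)

    -- k ≤ h(S)  (h(S) = min size of a hitting set)
    HittingAtLeast : ℕ → Set
    HittingAtLeast k = ∀ T → Hits T → k ≤ size T

    -- k ≤ e(S)  (e(S) = min size of an egg-cut, ∞ if none)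
    EggCutAtLeast : ℕ → Set
    EggCutAtLeast k = ∀ A → IsEggCut A → k ≤ cutSize A

    -- k ≤ order(S) = min(h(S), e(S))
    OrderAtLeast : ℕ → Set
    OrderAtLeast k = HittingAtLeast k × EggCutAtLeast k

  -- sn(G) < k : no scramble has order ≥ k
  ScrambleNumberBelow : ℕ → Set
  ScrambleNumberBelow k = ∀ (S : Scramble) → ¬ OrderAtLeast S k

allVecs : (n : ℕ) → List (Vec Bool n)
allVecs zero = [] ∷ []
allVecs (suc n) = map (false ∷_) (allVecs n) ++ map (true ∷_) (allVecs n)

hamming : ∀ {n} → Vec Bool n → Vec Bool n → ℕ
hamming [] [] = 0
hamming (false ∷ xs) (false ∷ ys) = hamming xs ys
hamming (true ∷ xs) (true ∷ ys) = hamming xs ys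
hamming (false ∷ xs) (true ∷ ys) = suc (hamming xs ys)
hamming (true ∷ xs) (false ∷ ys) = suc (hamming xs ys)

isOne : ℕ → Bool
isOne (suc zero) = true
isOne _ = false

Q : ℕ → FinGraph
Q n = record { V = Vec Bool n ; verts = allVecs n ; adj = λ u v → isOne (hamming u v) }

{-# OPTIONS --safe #-}
module Submission where

-- Write n = m + 1 and let T be the set of nonzero vertices of even weight, so |T| = 2^m − 1.
-- If T meets every egg then h < 2^m.  Otherwise some egg avoids T, i.e. lies among the odd
-- vertices and the origin 0.  The odd vertices are independent, so a connected such egg is
-- either a single vertex u, or contains 0 and stays inside its closed neighbourhood N[0].
-- Either A = {u} or A = N[0] contains an egg, is small (|A| ≤ n + 1), and has a small
-- boundary (at most n(n − 1) = (m + 1)m < 2^m edges for m ≥ 5).  So either A meets every egg,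
-- bounding h, or the complement of A contains an egg, making A an egg-cut that bounds e.

open import Defs
open import Data.Bool using (Bool; true; false; not; _∧_; _∨_; _xor_)
open import Data.Bool.Properties using (T?; _≟_; not-involutive; not-distribʳ-xor; ∨-zeroʳ; ∧-zeroʳ)
open import Data.Empty using (⊥; ⊥-elim)
open import Data.List using (List; []; _∷_; length; filter; map; concatMap; _++_)
open import Data.List.Properties using (length-++; length-map; map-cong)
open import Data.List.Membership.Propositional using (_∈_; find; lose)
open import Data.List.Membership.Propositional.Properties using (∈-map⁺; ∈-++⁺ˡ; ∈-++⁺ʳ)
open import Data.List.Relation.Unary.Any as Any using (any?)
open import Data.List.Relation.Unary.All as All using (all?)
open import Data.List.Relation.Unary.All.Properties using (¬All⇒Any¬)
open import Data.Nat using (ℕ; zero; suc; pred; _+_; _*_; _^_; _∸_; _≤_; _<_; _≤′_; ≤′-refl; ≤′-step; _≡ᵇ_; z≤n; s≤s)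
open import Data.Nat.ListAction using (sum)
open import Data.Nat.Properties hiding (_≟_)
open import Data.Product using (_×_; _,_; ∃-syntax; proj₁)
open import Data.Sum using (_⊎_; inj₁; inj₂; [_,_]′)
open import Data.Vec using (Vec; []; _∷_; replicate)
open import Function using (case_of_)
open import Relation.Binary.PropositionalEquality
open import Relation.Nullary using (¬_; Dec; yes; no; contradiction)
open import Relation.Nullary.Decidable using (_×-dec_)

private variable
  A B : Set
  n : ℕ

-- Phrased so that size G A and cutSize G A are literally counts.
count : (A → Bool) → List A → ℕ
count P xs = length (filter (λ x → T? (P x)) xs)

count-++ : ∀ (P : A → Bool) xs ys → count P (xs ++ ys) ≡ count P xs + count P ys
count-++ P [] ys = refl
count-++ P (x ∷ xs) ys with P x
... | true  = cong suc (count-++ P xs ys)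
... | false = count-++ P xs ys

count-map : ∀ (P : B → Bool) (f : A → B) xs → count P (map f xs) ≡ count (λ x → P (f x)) xs
count-map P f [] = refl
count-map P f (x ∷ xs) with P (f x)
... | true  = cong suc (count-map P f xs)
... | false = count-map P f xs

count-concatMap : ∀ (P : B → Bool) (f : A → List B) xs →
                  count P (concatMap f xs) ≡ sum (map (λ x → count P (f x)) xs)
count-concatMap P f [] = refl
count-concatMap P f (x ∷ xs) =
  trans (count-++ P (f x) (concatMap f xs)) (cong (count P (f x) +_) (count-concatMap P f xs))

count-cong : ∀ {P R : A → Bool} → (∀ x → P x ≡ R x) → ∀ xs → count P xs ≡ count R xs
count-cong P≗R [] = refl
count-cong {P = P} {R} P≗R (x ∷ xs) with P x | R x | P≗R x
... | true  | .true  | refl = cong suc (count-cong P≗R xs)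
... | false | .false | refl = count-cong P≗R xs

count-mono : ∀ {P R : A → Bool} → (∀ x → P x ≡ true → R x ≡ true) → ∀ xs → count P xs ≤ count R xs
count-mono P⇒R [] = z≤n
count-mono {P = P} {R} P⇒R (x ∷ xs) with P x in Px
... | true rewrite P⇒R x Px = s≤s (count-mono P⇒R xs)
... | false with R x
...   | true  = m≤n⇒m≤1+n (count-mono P⇒R xs)
...   | false = count-mono P⇒R xs

count-none : ∀ {P : A → Bool} → (∀ x → P x ≡ false) → ∀ xs → count P xs ≡ 0
count-none ¬P [] = refl
count-none {P = P} ¬P (x ∷ xs) with P x | ¬P x
... | false | refl = count-none ¬P xs

count-∨ : ∀ (P R : A → Bool) xs → count (λ x → P x ∨ R x) xs ≤ count P xs + count R xs
count-∨ P R [] = z≤n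
count-∨ P R (x ∷ xs) with P x | R x
... | true  | true  = s≤s (≤-trans (count-∨ P R xs) (+-monoʳ-≤ (count P xs) (n≤1+n (count R xs))))
... | true  | false = s≤s (count-∨ P R xs)
... | false | true  = ≤-trans (s≤s (count-∨ P R xs)) (≤-reflexive (sym (+-suc _ _)))
... | false | false = count-∨ P R xs

count-complement : ∀ (P : A → Bool) xs → count P xs + count (λ x → not (P x)) xs ≡ length xs
count-complement P [] = refl
count-complement P (x ∷ xs) with P x
... | true  = cong suc (count-complement P xs)
... | false = trans (+-suc _ _) (cong suc (count-complement P xs))

count-⊆-split : ∀ {P R : A → Bool} → (∀ x → R x ≡ true → P x ≡ true) →
                ∀ xs → count R xs + count (λ x → P x ∧ not (R x)) xs ≤ count P xs
count-⊆-split R⇒P [] = z≤n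
count-⊆-split {P = P} {R} R⇒P (x ∷ xs) with R x in Rx
... | true rewrite R⇒P x Rx = s≤s (count-⊆-split R⇒P xs)
... | false with P x
...   | true  = ≤-trans (≤-reflexive (+-suc _ _)) (s≤s (count-⊆-split R⇒P xs))
...   | false = count-⊆-split R⇒P xs

sum-≤-count : ∀ (f : A → ℕ) (B : A → Bool) c →
              (∀ x → B x ≡ false → f x ≡ 0) → (∀ x → B x ≡ true → f x ≤ c) →
              ∀ xs → sum (map f xs) ≤ count B xs * c
sum-≤-count f B c off on [] = z≤n
sum-≤-count f B c off on (x ∷ xs) with B x in Bx
... | true  = +-mono-≤ (on x Bx) (sum-≤-count f B c off on xs)
... | false rewrite off x Bx = sum-≤-count f B c off on xs

module _ (G : FinGraph) where
  open FinGraph G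

  Exhaustive : Set
  Exhaustive = ∀ v → v ∈ verts

  Meets : VSet G → VSet G → Set
  Meets A E = ∃[ v ] (A v ≡ true × E v ≡ true)

  meets? : Exhaustive → ∀ A E → Dec (Meets A E)
  meets? complete A E with any? (λ v → (A v ≟ true) ×-dec (E v ≟ true)) verts
  ... | yes p = let v , _ , AEv = find p in yes (v , AEv)
  ... | no ¬p = no λ (v , AEv) → ¬p (lose (complete v) AEv)

  hits⊎avoids : Exhaustive → ∀ (S : Scramble G) A → Hits G S A ⊎ ContainsEgg G S (complement G A)
  hits⊎avoids complete S A with all? (meets? complete A) (Scramble.eggs S)
  ... | yes meetsAll = inj₁ (All.lookup meetsAll)
  ... | no ¬meetsAll =
    let E , E∈ , ¬meets = find (¬All⇒Any¬ (meets? complete A) _ ¬meetsAll)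
    in inj₂ (E , E∈ , λ v Ev → outside v Ev ¬meets)
    where
    outside : ∀ {E} v → E v ≡ true → ¬ Meets A E → not (A v) ≡ true
    outside v Ev ¬meets with A v in Av
    ... | true  = contradiction (v , Av , Ev) ¬meets
    ... | false = refl

  small-egg-set⇒order< : Exhaustive → ∀ (S : Scramble G) {A k} → ContainsEgg G S A →
                         size G A < k → cutSize G A < k → ¬ OrderAtLeast G S k
  small-egg-set⇒order< complete S {A} eggA |A|<k cutA<k (hitting , cutting)
    with hits⊎avoids complete S A
  ... | inj₁ hitsA     = <⇒≱ |A|<k (hitting A hitsA)
  ... | inj₂ eggOutside = <⇒≱ cutA<k (cutting A (eggA , eggOutside))

  outDegree : VSet G → V → ℕ
  outDegree A u = count (λ w → not (A w) ∧ adj u w) verts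

  cutSize≡sum : ∀ A →
    cutSize G A ≡ sum (map (λ u → count (λ w → A u ∧ (not (A w) ∧ adj u w)) verts) verts)
  cutSize≡sum A =
    trans (count-concatMap _ _ verts) (cong sum (map-cong (λ u → count-map _ (u ,_) verts) verts))

  cutSize≤count*c : ∀ A (B : VSet G) c →
                    (∀ u → A u ≡ true → B u ≡ false → outDegree A u ≡ 0) →
                    (∀ u → A u ≡ true → B u ≡ true → outDegree A u ≤ c) →
                    cutSize G A ≤ count B verts * c
  cutSize≤count*c A B c off on =
    ≤-trans (≤-reflexive (cutSize≡sum A)) (sum-≤-count _ B c off′ on′ verts)
    where
    off′ : ∀ u → B u ≡ false → count (λ w → A u ∧ (not (A w) ∧ adj u w)) verts ≡ 0
    off′ u Bu with A u in Au
    ... | true  = off u Au Bu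
    ... | false = count-none (λ _ → refl) verts
    on′ : ∀ u → B u ≡ true → count (λ w → A u ∧ (not (A w) ∧ adj u w)) verts ≤ c
    on′ u Bu with A u in Au
    ... | true  = on u Au Bu
    ... | false = ≤-trans (≤-reflexive (count-none (λ _ → refl) verts)) z≤n

  Independent : VSet G → Set
  Independent I = ∀ u w → adj u w ≡ true → I u ≡ true → I w ≡ true → ⊥

  module _ {I : VSet G} (independent : Independent I) {E : VSet G} where

    reach-from-independent : (∀ v → E v ≡ true → I v ≡ true) → ∀ {u w} → I u ≡ true → Reach G E u w → w ≡ u
    reach-from-independent E⊆I Iu here = refl
    reach-from-independent E⊆I Iu (step u~v Ev _) = ⊥-elim (independent _ _ u~v Iu (E⊆I _ Ev))

    module _ {x : V} (E⊆I+x : ∀ v → E v ≡ true → I v ≡ true ⊎ v ≡ x) where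
      reach-from-hub  : ∀ {w} → Reach G E x w → w ≡ x ⊎ adj x w ≡ true
      reach-from-leaf : ∀ {v w} → I v ≡ true → adj x v ≡ true → Reach G E v w → w ≡ x ⊎ adj x w ≡ true

      reach-from-hub here = inj₁ refl
      reach-from-hub (step {v = v} x~v Ev walk) with E⊆I+x v Ev
      ... | inj₁ Iv   = reach-from-leaf Iv x~v walk
      ... | inj₂ refl = reach-from-hub walk

      reach-from-leaf Iv x~v here = inj₂ x~v
      reach-from-leaf Iv x~v (step {v = v′} v~v′ Ev′ walk) with E⊆I+x v′ Ev′
      ... | inj₁ Iv′  = ⊥-elim (independent _ _ v~v′ Iv Iv′)
      ... | inj₂ refl = reach-from-hub walk

    connected-in-independent : InducesConnected G E → (∀ v → E v ≡ true → I v ≡ true) →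
                               ∀ {u} → E u ≡ true → ∀ w → E w ≡ true → w ≡ u
    connected-in-independent connected E⊆I Eu w Ew =
      reach-from-independent E⊆I (E⊆I _ Eu) (connected _ w Eu Ew)

    connected-in-star : InducesConnected G E → ∀ {x} → E x ≡ true → (∀ v → E v ≡ true → I v ≡ true ⊎ v ≡ x) →
                        ∀ w → E w ≡ true → w ≡ x ⊎ adj x w ≡ true
    connected-in-star connected Ex E⊆I+x w Ew = reach-from-hub E⊆I+x (connected _ w Ex Ew)

allVecs-complete : Exhaustive (Q n)
allVecs-complete []                 = Any.here refl
allVecs-complete (false ∷ w)        = ∈-++⁺ˡ (∈-map⁺ (false ∷_) (allVecs-complete w))
allVecs-complete {suc n} (true ∷ w) = ∈-++⁺ʳ (map (false ∷_) (allVecs n)) (∈-map⁺ (true ∷_) (allVecs-complete w))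

length-allVecs : ∀ n → length (allVecs n) ≡ 2 ^ n
length-allVecs zero = refl
length-allVecs (suc n) = begin
  length (map (false ∷_) (allVecs n) ++ map (true ∷_) (allVecs n))
    ≡⟨ length-++ (map (false ∷_) (allVecs n)) ⟩
  length (map (false ∷_) (allVecs n)) + length (map (true ∷_) (allVecs n))
    ≡⟨ cong₂ _+_ (length-map (false ∷_) (allVecs n)) (length-map (true ∷_) (allVecs n)) ⟩
  length (allVecs n) + length (allVecs n)
    ≡⟨ cong₂ _+_ (length-allVecs n) (trans (length-allVecs n) (sym (+-identityʳ (2 ^ n)))) ⟩
  2 ^ suc n ∎
  where open ≡-Reasoning

count-allVecs-suc : ∀ (P : Vec Bool (suc n) → Bool) →
  count P (allVecs (suc n)) ≡ count (λ w → P (false ∷ w)) (allVecs n) + count (λ w → P (true ∷ w)) (allVecs n)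
count-allVecs-suc {n} P = begin
  count P (map (false ∷_) (allVecs n) ++ map (true ∷_) (allVecs n))
    ≡⟨ count-++ P (map (false ∷_) (allVecs n)) _ ⟩
  count P (map (false ∷_) (allVecs n)) + count P (map (true ∷_) (allVecs n))
    ≡⟨ cong₂ _+_ (count-map P (false ∷_) (allVecs n)) (count-map P (true ∷_) (allVecs n)) ⟩
  count (λ w → P (false ∷ w)) (allVecs n) + count (λ w → P (true ∷ w)) (allVecs n) ∎
  where open ≡-Reasoning

hamming-self : ∀ (u : Vec Bool n) → hamming u u ≡ 0
hamming-self []          = refl
hamming-self (false ∷ u) = hamming-self u
hamming-self (true ∷ u)  = hamming-self u

hamming-sym : ∀ (u w : Vec Bool n) → hamming u w ≡ hamming w u
hamming-sym []          []          = refl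
hamming-sym (false ∷ u) (false ∷ w) = hamming-sym u w
hamming-sym (false ∷ u) (true ∷ w)  = cong suc (hamming-sym u w)
hamming-sym (true ∷ u)  (false ∷ w) = cong suc (hamming-sym u w)
hamming-sym (true ∷ u)  (true ∷ w)  = hamming-sym u w

isOne-suc : ∀ h → isOne (suc h) ≡ (h ≡ᵇ 0)
isOne-suc zero    = refl
isOne-suc (suc h) = refl

singleton : Vec Bool n → Vec Bool n → Bool
singleton u w = hamming u w ≡ᵇ 0

adjacent : Vec Bool n → Vec Bool n → Bool
adjacent u w = isOne (hamming u w)

closedNbhd : Vec Bool n → Vec Bool n → Bool
closedNbhd u w = singleton u w ∨ adjacent u w

singleton-self : ∀ (u : Vec Bool n) → singleton u u ≡ true
singleton-self u = cong (_≡ᵇ 0) (hamming-self u)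

singleton⇒≡ : ∀ (u w : Vec Bool n) → singleton u w ≡ true → w ≡ u
singleton⇒≡ []          []          _  = refl
singleton⇒≡ (false ∷ u) (false ∷ w) eq = cong (false ∷_) (singleton⇒≡ u w eq)
singleton⇒≡ (true ∷ u)  (true ∷ w)  eq = cong (true ∷_) (singleton⇒≡ u w eq)

adjacent-sym : ∀ (u w : Vec Bool n) → adjacent u w ≡ adjacent w u
adjacent-sym u w = cong isOne (hamming-sym u w)

closedNbhd-centre : ∀ (u : Vec Bool n) → closedNbhd u u ≡ true
closedNbhd-centre u rewrite singleton-self u = refl

closedNbhd-adjacent : ∀ (u w : Vec Bool n) → adjacent u w ≡ true → closedNbhd u w ≡ true
closedNbhd-adjacent u w u~w rewrite u~w = ∨-zeroʳ (singleton u w)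

count-singleton : ∀ (u : Vec Bool n) → count (singleton u) (allVecs n) ≡ 1
count-singleton []                  = refl
count-singleton {suc n} (false ∷ u) = trans (count-allVecs-suc (singleton (false ∷ u)))
  (cong₂ _+_ (count-singleton u) (count-none (λ _ → refl) (allVecs n)))
count-singleton {suc n} (true ∷ u)  = trans (count-allVecs-suc (singleton (true ∷ u)))
  (cong₂ _+_ (count-none (λ _ → refl) (allVecs n)) (count-singleton u))

count-isOne-suc : ∀ (u : Vec Bool n) → count (λ w → isOne (suc (hamming u w))) (allVecs n) ≡ 1
count-isOne-suc {n} u = trans (count-cong (λ w → isOne-suc (hamming u w)) (allVecs n)) (count-singleton u)

count-adjacent : ∀ (u : Vec Bool n) → count (adjacent u) (allVecs n) ≡ n
count-adjacent []                  = refl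
count-adjacent {suc n} (false ∷ u) = begin
  count (adjacent (false ∷ u)) (allVecs (suc n))
    ≡⟨ count-allVecs-suc (adjacent (false ∷ u)) ⟩
  count (adjacent u) (allVecs n) + count (λ w → isOne (suc (hamming u w))) (allVecs n)
    ≡⟨ cong₂ _+_ (count-adjacent u) (count-isOne-suc u) ⟩
  n + 1
    ≡⟨ +-comm n 1 ⟩
  suc n ∎
  where open ≡-Reasoning
count-adjacent {suc n} (true ∷ u)  = begin
  count (adjacent (true ∷ u)) (allVecs (suc n))
    ≡⟨ count-allVecs-suc (adjacent (true ∷ u)) ⟩
  count (λ w → isOne (suc (hamming u w))) (allVecs n) + count (adjacent u) (allVecs n)
    ≡⟨ cong₂ _+_ (count-isOne-suc u) (count-adjacent u) ⟩
  suc n ∎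
  where open ≡-Reasoning

zeros : ∀ n → Vec Bool n
zeros n = replicate n false

evenWeight : Vec Bool n → Bool
evenWeight []      = true
evenWeight (b ∷ w) = b xor evenWeight w

oddWeight : Vec Bool n → Bool
oddWeight w = not (evenWeight w)

evenNonzero : Vec Bool n → Bool
evenNonzero {n} w = evenWeight w ∧ not (singleton (zeros n) w)

evenWeight-zeros : ∀ n → evenWeight (zeros n) ≡ true
evenWeight-zeros zero    = refl
evenWeight-zeros (suc n) = evenWeight-zeros n

count-evenWeight : ∀ n → count evenWeight (allVecs (suc n)) ≡ 2 ^ n
count-evenWeight n = begin
  count evenWeight (allVecs (suc n))                                   ≡⟨ count-allVecs-suc {n} evenWeight ⟩
  count evenWeight (allVecs n) + count oddWeight (allVecs n)           ≡⟨ count-complement evenWeight (allVecs n) ⟩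
  length (allVecs n)                                                   ≡⟨ length-allVecs n ⟩
  2 ^ n                                                                ∎
  where open ≡-Reasoning

evenWeight-flip : ∀ (u w : Vec Bool n) → adjacent u w ≡ true → evenWeight w ≡ not (evenWeight u)
evenWeight-flip []          []          ()
evenWeight-flip (false ∷ u) (false ∷ w) u~w = evenWeight-flip u w u~w
evenWeight-flip (true ∷ u)  (true ∷ w)  u~w =
  trans (cong not (evenWeight-flip u w u~w)) (sym (not-distribʳ-xor true (evenWeight u)))
evenWeight-flip (false ∷ u) (true ∷ w)  u~w
  rewrite singleton⇒≡ u w (trans (sym (isOne-suc (hamming u w))) u~w) = refl
evenWeight-flip (true ∷ u)  (false ∷ w) u~w
  rewrite singleton⇒≡ u w (trans (sym (isOne-suc (hamming u w))) u~w) = sym (not-involutive (evenWeight u))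

oddWeight-independent : Independent (Q n) oddWeight
oddWeight-independent u w u~w oddU oddW
  with evenWeight u | evenWeight w | evenWeight-flip u w u~w
... | false | false | ()

¬evenNonzero⇒odd⊎zeros : ∀ (v : Vec Bool n) → not (evenNonzero v) ≡ true → oddWeight v ≡ true ⊎ v ≡ zeros n
¬evenNonzero⇒odd⊎zeros {n} v ¬evenNonzero with evenWeight v | singleton (zeros n) v in v≡0 | ¬evenNonzero
... | false | _    | _ = inj₁ refl
... | true  | true | _ = inj₂ (singleton⇒≡ (zeros n) v v≡0)

connected-avoiding-evenNonzero : ∀ {E} → InducesConnected (Q n) E → Nonempty (Q n) E →
  _⊆_ (Q n) E (complement (Q n) evenNonzero) →
  _⊆_ (Q n) E (closedNbhd (zeros n)) ⊎ ∃[ u ] _⊆_ (Q n) E (singleton u)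
connected-avoiding-evenNonzero {n} {E} connected (u , Eu) avoids with E (zeros n) in E0
... | true  = inj₁ λ w Ew →
  [ (λ { refl → closedNbhd-centre (zeros n) }) , closedNbhd-adjacent (zeros n) w ]′
  (connected-in-star (Q n) oddWeight-independent connected E0
     (λ v Ev → ¬evenNonzero⇒odd⊎zeros v (avoids v Ev)) w Ew)
... | false = inj₂ (u , λ w Ew →
  subst (λ x → singleton u x ≡ true)
        (sym (connected-in-independent (Q n) oddWeight-independent connected odd Eu w Ew))
        (singleton-self u))
  where
  odd : ∀ v → E v ≡ true → oddWeight v ≡ true
  odd v Ev with ¬evenNonzero⇒odd⊎zeros v (avoids v Ev)
  ... | inj₁ oddV = oddV
  ... | inj₂ refl with () ← trans (sym Ev) E0

∧-elimʳ : ∀ a {b} → a ∧ b ≡ true → b ≡ true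
∧-elimʳ true b = b

outDegree≤n : ∀ (A : Vec Bool n → Bool) v → outDegree (Q n) A v ≤ n
outDegree≤n {n} A v = begin
  outDegree (Q n) A v             ≤⟨ count-mono (λ w → ∧-elimʳ (not (A w))) (allVecs n) ⟩
  count (adjacent v) (allVecs n)  ≡⟨ count-adjacent v ⟩
  n                               ∎
  where open ≤-Reasoning

size-singleton : ∀ (u : Vec Bool n) → size (Q n) (singleton u) ≡ 1
size-singleton = count-singleton

cutSize-singleton : ∀ (u : Vec Bool n) → cutSize (Q n) (singleton u) ≤ n
cutSize-singleton {n} u = begin
  cutSize (Q n) (singleton u)          ≤⟨ cutSize≤count*c (Q n) (singleton u) (singleton u) n
                                             (λ v in₁ in₂ → case trans (sym in₁) in₂ of λ ())
                                             (λ v _ _ → outDegree≤n (singleton u) v) ⟩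
  count (singleton u) (allVecs n) * n  ≡⟨ cong (_* n) (count-singleton u) ⟩
  1 * n                                ≡⟨ *-identityˡ n ⟩
  n                                    ∎
  where open ≤-Reasoning

size-closedNbhd : ∀ (u : Vec Bool n) → size (Q n) (closedNbhd u) ≤ suc n
size-closedNbhd {n} u = begin
  size (Q n) (closedNbhd u)                                         ≤⟨ count-∨ (singleton u) (adjacent u) (allVecs n) ⟩
  count (singleton u) (allVecs n) + count (adjacent u) (allVecs n)  ≡⟨ cong₂ _+_ (count-singleton u) (count-adjacent u) ⟩
  suc n                                                             ∎
  where open ≤-Reasoning

-- Each edge leaving N[u] goes from a neighbour v of u to a vertex other than u.
cutSize-closedNbhd : ∀ (u : Vec Bool n) → cutSize (Q n) (closedNbhd u) ≤ n * pred n
cutSize-closedNbhd {n} u = begin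
  cutSize (Q n) (closedNbhd u)             ≤⟨ cutSize≤count*c (Q n) (closedNbhd u) (adjacent u) (pred n) centre leaf ⟩
  count (adjacent u) (allVecs n) * pred n  ≡⟨ cong (_* pred n) (count-adjacent u) ⟩
  n * pred n                               ∎
  where
  open ≤-Reasoning
  centre : ∀ v → closedNbhd u v ≡ true → adjacent u v ≡ false → outDegree (Q n) (closedNbhd u) v ≡ 0
  centre v Nv ¬u~v with singleton u v in u≡v
  ... | true rewrite singleton⇒≡ u v u≡v = count-none no-exit (allVecs n)
    where
    no-exit : ∀ w → not (closedNbhd u w) ∧ adjacent u w ≡ false
    no-exit w with singleton u w | adjacent u w
    ... | true  | true  = refl
    ... | false | true  = refl
    ... | _     | false = ∧-zeroʳ _
  ... | false with () ← trans (sym Nv) ¬u~v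
  leaf : ∀ v → closedNbhd u v ≡ true → adjacent u v ≡ true → outDegree (Q n) (closedNbhd u) v ≤ pred n
  leaf v _ u~v = ≤-trans (count-mono (λ w → outside-N⇒ (singleton u w) (adjacent u w) _) (allVecs n))
                         (pred-mono-≤ 1+others≤n)
    where
    outside-N⇒ : ∀ a b c → not (a ∨ b) ∧ c ≡ true → c ∧ not a ≡ true
    outside-N⇒ false false true refl = refl
    v~u : ∀ w → singleton u w ≡ true → adjacent v w ≡ true
    v~u w u≡w rewrite singleton⇒≡ u w u≡w = trans (adjacent-sym v u) u~v
    others : ℕ
    others = count (λ w → adjacent v w ∧ not (singleton u w)) (allVecs n)
    1+others≤n : 1 + others ≤ n
    1+others≤n = begin
      1 + others                                ≡⟨ cong (_+ others) (count-singleton u) ⟨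
      count (singleton u) (allVecs n) + others  ≤⟨ count-⊆-split v~u (allVecs n) ⟩
      count (adjacent v) (allVecs n)            ≡⟨ count-adjacent v ⟩
      n                                         ∎

size-evenNonzero : ∀ m → size (Q (suc m)) evenNonzero < 2 ^ m
size-evenNonzero m = begin-strict
  T                                                     <⟨ n<1+n T ⟩
  1 + T                                                 ≡⟨ cong (_+ T) (count-singleton (zeros (suc m))) ⟨
  count (singleton (zeros (suc m))) (allVecs (suc m)) + T
                                                        ≤⟨ count-⊆-split zeros-even (allVecs (suc m)) ⟩
  count evenWeight (allVecs (suc m))                    ≡⟨ count-evenWeight m ⟩
  2 ^ m                                                 ∎
  where
  open ≤-Reasoning
  T : ℕ
  T = size (Q (suc m)) evenNonzero
  zeros-even : ∀ w → singleton (zeros (suc m)) w ≡ true → evenWeight w ≡ true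
  zeros-even w 0≡w rewrite singleton⇒≡ (zeros (suc m)) w 0≡w = evenWeight-zeros (suc m)

[1+m]*m<2^m : ∀ {m} → 5 ≤ m → (1 + m) * m < 2 ^ m
[1+m]*m<2^m 5≤m = go (≤⇒≤′ 5≤m)
  where
  go : ∀ {m} → 5 ≤′ m → (1 + m) * m < 2 ^ m
  go ≤′-refl = n≤1+n 31
  go {suc m} (≤′-step 5≤′m) = begin-strict
    (2 + m) * (1 + m)          ≡⟨ *-comm (2 + m) (1 + m) ⟩
    (1 + m) * (2 + m)          ≤⟨ *-monoʳ-≤ (1 + m) (+-monoˡ-≤ m (≤-trans (s≤s (s≤s z≤n)) (≤′⇒≤ 5≤′m))) ⟩
    (1 + m) * (m + m)          ≡⟨ *-distribˡ-+ (1 + m) m m ⟩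
    (1 + m) * m + (1 + m) * m  <⟨ +-mono-< (go 5≤′m) (go 5≤′m) ⟩
    2 ^ m + 2 ^ m              ≡⟨ cong (2 ^ m +_) (+-identityʳ (2 ^ m)) ⟨
    2 ^ suc m                  ∎
    where open ≤-Reasoning

2+m≤[1+m]*m : ∀ {m} → 2 ≤ m → 2 + m ≤ (1 + m) * m
2+m≤[1+m]*m {m@(suc _)} 2≤m = begin
  2 + m      ≡⟨ +-comm 2 m ⟩
  m + 2      ≤⟨ +-monoʳ-≤ m (≤-trans 2≤m (m≤m*n m m)) ⟩
  m + m * m  ∎
  where open ≤-Reasoning

theorem3p16 : ∀ (n : ℕ) → 6 ≤ n → ScrambleNumberBelow (Q n) (2 ^ (n ∸ 1))
theorem3p16 (suc m) (s≤s 5≤m) S order with hits⊎avoids (Q (suc m)) allVecs-complete S evenNonzero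
... | inj₁ hitsT = <⇒≱ (size-evenNonzero m) (proj₁ order evenNonzero hitsT)
... | inj₂ (E , E∈ , E⊆) =
  [ (λ E⊆N → refute (E , E∈ , E⊆N)
                    (≤-trans (size-closedNbhd (zeros (suc m))) 2+m≤)
                    (cutSize-closedNbhd (zeros (suc m))))
  , (λ (u , E⊆u) → refute (E , E∈ , E⊆u)
                          (≤-trans (≤-reflexive (size-singleton u)) (≤-trans (s≤s z≤n) 2+m≤))
                          (≤-trans (cutSize-singleton u) (≤-trans (n≤1+n (suc m)) 2+m≤)))
  ]′ (connected-avoiding-evenNonzero (Scramble.connected S E∈) (Scramble.nonempty S E∈) E⊆)
  where
  2+m≤ : 2 + m ≤ suc m * m
  2+m≤ = 2+m≤[1+m]*m (≤-trans (s≤s (s≤s z≤n)) 5≤m)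
  refute : ∀ {A} → ContainsEgg (Q (suc m)) S A →
           size (Q (suc m)) A ≤ suc m * m → cutSize (Q (suc m)) A ≤ suc m * m → ⊥
  refute eggA |A|≤ cutA≤ = small-egg-set⇒order< (Q (suc m)) allVecs-complete S eggA
    (≤-<-trans |A|≤ ([1+m]*m<2^m 5≤m)) (≤-<-trans cutA≤ ([1+m]*m<2^m 5≤m)) order
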